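{- Let $\lambda$ be an integer partition. If $\lambda$ is Latin, then $\lambda$ is strongly Latin.
   Context: A tableau of shape $\lambda$ is the Young diagram of $\lambda$ (row $i$ has $\lambda_i$ cells, cell $(i,j)$ exists iff $j\le\lambda_i$) with a positive integer in each cell; no semistandardness is assumed. $\lambda'$ denotes the conjugate partition. A Latin tableau of shape $\lambda$ and content $\mu$ is a tableau of shape $\lambda$ in which no two cells in the same row or the same column have the same entry, and the total number of occurrences of the integer $i$ equals $\mu_i$ for every $i$. The partition $\lambda$ is Latin if there exists a Latin tableau of shape $\lambda$ and content $\lambda'$. The partition $\lambda$ is strongly Latin if for every sequence $(I_i)_{i=1}^{\ell(\lambda)}$ of sets of integers with $|I_i|=\lambda_i$ for all $i$, there exists a tableau $T$ of shape $\lambda$ (entries integers) such that (a) for every $i$ the set of entries in row $i$ of $T$ is exactly $I_i$, and (b) for every $j$ the entries in column $j$ of $T$ are pairwise distinct. -}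

module Defs where

open import Data.Nat using (ℕ; zero; suc; _+_; _≤_; _<_; _≤?_; _≟_)
open import Data.Integer using (ℤ)
open import Data.List using (List; []; _∷_; length; filter)
open import Data.List.Relation.Unary.All using (All)
open import Data.List.Relation.Unary.Linked using (Linked)
open import Data.List.Relation.Unary.Unique.Propositional using (Unique)
open import Data.List.Membership.Propositional using (_∈_)
open import Data.Product using (Σ; ∃; _×_)
open import Function.Bundles using (_⇔_)
open import Relation.Nullary using (¬_; yes; no)
open import Relation.Binary.PropositionalEquality using (_≡_; _≢_)

IsPartition : List ℕ → Set
IsPartition la = All (λ x → 0 < x) la × Linked (λ a b → b ≤ a) la

-- Length of row i (rows are 0-indexed here); 0 beyond the last row.
row : List ℕ → ℕ → ℕ
row []       _       = 0
row (x ∷ xs) zero    = x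
row (x ∷ xs) (suc i) = row xs i

-- Conjugate partition, 1-indexed: conj λ k = #{ i : λ_i ≥ k } (for k ≥ 1).
conj : List ℕ → ℕ → ℕ
conj la k = length (filter (k ≤?_) la)

countBelow : (ℕ → ℕ) → ℕ → ℕ → ℕ
countBelow f k zero    = 0
countBelow f k (suc n) with f n ≟ k
... | yes _ = suc (countBelow f k n)
... | no  _ = countBelow f k n

-- number of cells (i , j) of the diagram of λ with T i j ≡ k
-- (cells are 0-indexed: (i , j) is a cell iff j < row λ i)
occurrences : List ℕ → (ℕ → ℕ → ℕ) → ℕ → ℕ
occurrences []       T k = 0
occurrences (x ∷ xs) T k = countBelow (T 0) k x + occurrences xs (λ i → T (suc i)) k

-- A tableau of shape λ is a filling T : ℕ → ℕ → A; only values at cells matter.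
RowsDistinct : {A : Set} → List ℕ → (ℕ → ℕ → A) → Set
RowsDistinct la T = ∀ i j j' → j < row la i → j' < row la i → j ≢ j' → T i j ≢ T i j'

ColumnsDistinct : {A : Set} → List ℕ → (ℕ → ℕ → A) → Set
ColumnsDistinct la T = ∀ i i' j → j < row la i → j < row la i' → i ≢ i' → T i j ≢ T i' j

-- Latin tableau of shape λ and content μ (μ indexed from 1: μ k = μ_k).
IsLatinTableau : List ℕ → (ℕ → ℕ) → (ℕ → ℕ → ℕ) → Set
IsLatinTableau la μ T =
  (∀ i j → j < row la i → 1 ≤ T i j) ×
  RowsDistinct la T ×
  ColumnsDistinct la T ×
  (∀ k → 1 ≤ k → occurrences la T k ≡ μ k)

Latin : List ℕ → Set
Latin la = ∃ λ T → IsLatinTableau la (conj la) T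

-- Strongly Latin: for every family (I_i) of sets of integers with |I_i| = λ_i
-- (finite sets represented as duplicate-free lists), there is an integer
-- tableau whose row i has entry set exactly I_i and whose columns have
-- pairwise distinct entries.
StronglyLatin : List ℕ → Set
StronglyLatin la =
  (I : ℕ → List ℤ) →
  (∀ i → i < length la → Unique (I i) × length (I i) ≡ row la i) →
  Σ (ℕ → ℕ → ℤ) λ T →
    (∀ i → i < length la → ∀ x → (x ∈ I i) ⇔ (∃ λ j → j < row la i × T i j ≡ x)) ×
    ColumnsDistinct la T

{-# OPTIONS --safe #-}
-- In a Latin tableau T of shape λ and content λ′, row i consists exactly of 1, …, λᵢ: by
-- descending induction on k, an entry k in a row shorter than k would force k to occur in
-- every row of length at least k as well, hence more than λ′ₖ times.
--
-- Read T as a labelling of the cells, and orient each row towards larger labels and each column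
-- towards smaller ones. Cell (i , j) then has at most (λᵢ − T i j) + (T i j − 1) < λᵢ = |Iᵢ|
-- out-neighbours, and Galvin's kernel method applies: for one integer x at a time, the uncoloured
-- cells whose row set contains x carry a kernel (found by Gale–Shapley style deletions), which meets
-- each of these rows exactly once. Give it colour x, delete it and remove x from the row sets;
-- every remaining cell in those rows loses an out-neighbour, so the out-degree bound persists.
module Submission where

open import Data.Empty using (⊥-elim)
open import Data.Integer using (ℤ; 0ℤ)
import Data.Integer as ℤ
open import Data.List using (List; []; _∷_; length; filter; concat; applyUpTo)
open import Data.List.Membership.DecPropositional ℤ._≟_ using (_∈?_)
open import Data.List.Membership.Propositional using (_∈_; _∉_)
open import Data.List.Membership.Propositional.Properties
  using (∈-filter⁺; ∈-filter⁻; ∈-concat⁺′; ∈-applyUpTo⁺; ∈-length)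
open import Data.List.Properties using (filter-all; filter-accept; filter-reject)
import Data.List.Relation.Unary.All as All
open import Data.List.Relation.Unary.All.Properties using (¬Any⇒All¬; All¬⇒¬Any)
open import Data.List.Relation.Unary.AllPairs using (_∷_)
open import Data.List.Relation.Unary.Any using (here; there)
open import Data.List.Relation.Unary.Unique.Propositional using (Unique)
import Data.List.Relation.Unary.Unique.Propositional.Properties as Unique
open import Data.Nat
open import Data.Nat.Induction using (<-wellFounded)
open import Data.Nat.ListAction using (sum)
open import Data.Nat.Properties
open import Data.Product using (∃; _×_; _,_; proj₁; proj₂; uncurry)
open import Data.Product.Properties using (≡-dec)
open import Data.Sum using (_⊎_; inj₁; inj₂; [_,_]′)
open import Function using (_∘_; id; flip)
open import Function.Bundles using (_⇔_; mk⇔; Equivalence)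
open import Induction.WellFounded using (Acc; acc)
open import Level using (Level; 0ℓ)
open import Relation.Binary using (Rel; Transitive; Total; DecidableEquality)
open import Relation.Binary.PropositionalEquality
open import Relation.Nullary using (¬_; Dec; yes; no; contradiction; ¬?; _×-dec_; _→-dec_)
open import Relation.Nullary.Decidable using (decidable-stable)
open import Relation.Unary using (Pred; Decidable; _⊆_; _∖_; ｛_｝)
open import Relation.Unary.Properties using (_∩?_; ∁?)

open import Defs

private
  variable
    a b p q r : Level
    A : Set a
    B : Set b
    P : Pred ℕ p
    Q : Pred ℕ q

-- Counting on initial segments of ℕ

indicator : Dec A → ℕ
indicator (yes _) = 1
indicator (no _)  = 0

indicator-yes : (a? : Dec A) → A → indicator a? ≡ 1
indicator-yes (yes _) _ = refl
indicator-yes (no ¬a) a = contradiction a ¬a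

indicator-no : (a? : Dec A) → ¬ A → indicator a? ≡ 0
indicator-no (no _)  _  = refl
indicator-no (yes a) ¬a = contradiction a ¬a

indicator-mono : (A → B) → (a? : Dec A) (b? : Dec B) → indicator a? ≤ indicator b?
indicator-mono A⇒B (no _)  _       = z≤n
indicator-mono A⇒B (yes _) (yes _) = ≤-refl
indicator-mono A⇒B (yes a) (no ¬b) = contradiction (A⇒B a) ¬b

indicator-mono-< : ¬ A → B → (a? : Dec A) (b? : Dec B) → indicator a? < indicator b?
indicator-mono-< ¬a b (no _)  (yes _) = ≤-refl
indicator-mono-< ¬a b (yes a) _       = contradiction a ¬a
indicator-mono-< ¬a b _       (no ¬b) = contradiction b ¬b

indicator-cong : (A → B) → (B → A) → (a? : Dec A) (b? : Dec B) → indicator a? ≡ indicator b?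
indicator-cong A⇒B B⇒A a? b? = ≤-antisym (indicator-mono A⇒B a? b?) (indicator-mono B⇒A b? a?)

sumBelow : ℕ → (ℕ → ℕ) → ℕ
sumBelow zero    f = 0
sumBelow (suc n) f = f n + sumBelow n f

sumBelow-mono-≤ : ∀ n {f g : ℕ → ℕ} → (∀ {k} → k < n → f k ≤ g k) → sumBelow n f ≤ sumBelow n g
sumBelow-mono-≤ zero    f≤g = z≤n
sumBelow-mono-≤ (suc n) f≤g = +-mono-≤ (f≤g ≤-refl) (sumBelow-mono-≤ n (f≤g ∘ m<n⇒m<1+n))

sumBelow-mono-< : ∀ n {f g : ℕ → ℕ} → (∀ {k} → k < n → f k ≤ g k) →
                  ∀ {k} → k < n → f k < g k → sumBelow n f < sumBelow n g
sumBelow-mono-< (suc n) f≤g k<1+n fk<gk with m<1+n⇒m<n∨m≡n k<1+n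
... | inj₁ k<n  = +-mono-≤-< (f≤g ≤-refl) (sumBelow-mono-< n (f≤g ∘ m<n⇒m<1+n) k<n fk<gk)
... | inj₂ refl = +-mono-<-≤ fk<gk (sumBelow-mono-≤ n (f≤g ∘ m<n⇒m<1+n))

count : Decidable P → ℕ → ℕ
count P? n = sumBelow n (indicator ∘ P?)

count-mono-≤ : (P? : Decidable P) (Q? : Decidable Q) → ∀ n → (∀ {k} → k < n → P k → Q k) →
               count P? n ≤ count Q? n
count-mono-≤ P? Q? n P⇒Q = sumBelow-mono-≤ n λ {k} k<n → indicator-mono (P⇒Q k<n) (P? k) (Q? k)

count-mono-< : (P? : Decidable P) (Q? : Decidable Q) → ∀ n → (∀ {k} → k < n → P k → Q k) →
               ∀ {k} → k < n → ¬ P k → Q k → count P? n < count Q? n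
count-mono-< P? Q? n P⇒Q {k} k<n ¬Pk Qk =
  sumBelow-mono-< n (λ {k′} k′<n → indicator-mono (P⇒Q k′<n) (P? k′) (Q? k′))
                  k<n (indicator-mono-< ¬Pk Qk (P? k) (Q? k))

count-cong : (P? : Decidable P) (Q? : Decidable Q) → ∀ n →
             (∀ {k} → k < n → P k → Q k) → (∀ {k} → k < n → Q k → P k) → count P? n ≡ count Q? n
count-cong P? Q? n P⇒Q Q⇒P = ≤-antisym (count-mono-≤ P? Q? n P⇒Q) (count-mono-≤ Q? P? n Q⇒P)

count-remove : (P? : Decidable P) → ∀ {n k} → k < n → P k →
               count P? n ≡ suc (count (P? ∩? ∁? (_≟ k)) n)
count-remove P? {suc n} {k} k<1+n Pk with m<1+n⇒m<n∨m≡n k<1+n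
... | inj₁ k<n = begin
  indicator (P? n) + count P? n            ≡⟨ cong₂ _+_ (indicator-cong (_, >⇒≢ k<n) proj₁ (P? n) (P∖k? n))
                                                        (count-remove P? k<n Pk) ⟩
  indicator (P∖k? n) + suc (count P∖k? n)  ≡⟨ +-suc _ _ ⟩
  suc (indicator (P∖k? n) + count P∖k? n)  ∎
  where
  open ≡-Reasoning
  P∖k? = P? ∩? ∁? (_≟ k)
... | inj₂ refl = cong₂ _+_
  (trans (indicator-yes (P? k) Pk) (cong suc (sym (indicator-no (P∖k? k) λ (_ , k≢k) → k≢k refl))))
  (count-cong P? P∖k? k (λ j<k Pj → Pj , <⇒≢ j<k) (λ _ → proj₁))
  where
  P∖k? = P? ∩? ∁? (_≟ k)

∃⇒0<count : (P? : Decidable P) → ∀ {n k} → k < n → P k → 0 < count P? n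
∃⇒0<count P? k<n Pk = subst (0 <_) (sym (count-remove P? k<n Pk)) z<s

count≡0⇒¬ : (P? : Decidable P) → ∀ {n} → count P? n ≡ 0 → ∀ {k} → k < n → ¬ P k
count≡0⇒¬ P? count≡0 k<n Pk = <⇒≢ (∃⇒0<count P? k<n Pk) (sym count≡0)

0<count⇒∃ : (P? : Decidable P) → ∀ n → 0 < count P? n → ∃ λ k → k < n × P k
0<count⇒∃ P? (suc n) 0<count with P? n
... | yes Pn = n , ≤-refl , Pn
... | no _   = let k , k<n , Pk = 0<count⇒∃ P? n 0<count in k , m<n⇒m<1+n k<n , Pk

count-all : (P? : Decidable P) → ∀ n → (∀ {k} → k < n → P k) → count P? n ≡ n
count-all P? zero    _   = refl
count-all P? (suc n) all = cong₂ _+_ (indicator-yes (P? n) (all ≤-refl)) (count-all P? n (all ∘ m<n⇒m<1+n))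

count-below : ∀ {r} n → r ≤ n → count (_<? r) n ≡ r
count-below zero    z≤n   = refl
count-below {r} (suc n) r≤1+n with m≤n⇒m<n∨m≡n r≤1+n
... | inj₁ r<1+n = cong₂ _+_ (indicator-no (n <? r) (≤⇒≯ r≤n)) (count-below n r≤n)
  where r≤n = m<1+n⇒m≤n r<1+n
... | inj₂ refl  = count-all (_<? suc n) (suc n) id

count-above : ∀ a n → count (a <?_) n ≡ n ∸ suc a
count-above a zero    = refl
count-above a (suc n) with a <? n
... | yes a<n = trans (cong suc (count-above a n)) (sym (+-∸-assoc 1 a<n))
... | no  a≮n = trans (count-above a n) (trans (m≤n⇒m∸n≡0 (m≤n⇒m≤1+n n≤a)) (sym (m≤n⇒m∸n≡0 n≤a)))
  where n≤a = ≮⇒≥ a≮n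

count-injection : (P? : Decidable P) (Q? : Decidable Q) (g : ℕ → ℕ) → ∀ n m →
                  (∀ {k} → k < n → P k → g k < m × Q (g k)) →
                  (∀ {k k′} → k < n → k′ < n → P k → P k′ → g k ≡ g k′ → k ≡ k′) →
                  count P? n ≤ count Q? m
count-injection P? Q? g zero    m maps inj = z≤n
count-injection {P = P} {Q = Q} P? Q? g (suc n) m maps inj with P? n
... | no _   = count-injection P? Q? g n m (maps ∘ m<n⇒m<1+n)
                 (λ k<n k′<n → inj (m<n⇒m<1+n k<n) (m<n⇒m<1+n k′<n))
... | yes Pn = begin
  suc (count P? n)                   ≤⟨ s≤s (count-injection P? (Q? ∩? ∁? (_≟ g n)) g n m maps′
                                          (λ k<n k′<n → inj (m<n⇒m<1+n k<n) (m<n⇒m<1+n k′<n))) ⟩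
  suc (count (Q? ∩? ∁? (_≟ g n)) m)  ≡⟨ count-remove Q? gn<m Qgn ⟨
  count Q? m                         ∎
  where
  open ≤-Reasoning
  gn<m = proj₁ (maps ≤-refl Pn)
  Qgn  = proj₂ (maps ≤-refl Pn)
  maps′ : ∀ {k} → k < n → P k → g k < m × Q (g k) × g k ≢ g n
  maps′ k<n Pk = let gk<m , Qgk = maps (m<n⇒m<1+n k<n) Pk
                 in gk<m , Qgk , λ gk≡gn → <⇒≢ k<n (inj (m<n⇒m<1+n k<n) ≤-refl Pk Pn gk≡gn)

injection-hits-every-value : ∀ r (f : ℕ → ℕ) → (∀ {j} → j < r → 1 ≤ f j × f j ≤ r) →
                             (∀ {j j′} → j < r → j′ < r → f j ≡ f j′ → j ≡ j′) →
                             ∀ {k} → 1 ≤ k → k ≤ r → ∃ λ j → j < r × f j ≡ k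
injection-hits-every-value r f range injective {k} 1≤k k≤r with anyUpTo? (λ j → f j ≟ k) r
... | yes hit  = hit
... | no  miss = contradiction (begin-strict
  r                                ≡⟨ count-all (_<? r) r id ⟨
  count (_<? r) r                  ≤⟨ count-injection (_<? r) positive≢k? f r (suc r) maps
                                        (λ j<r j′<r _ _ → injective j<r j′<r) ⟩
  count positive≢k? (suc r)        <⟨ n<1+n _ ⟩
  suc (count positive≢k? (suc r))  ≡⟨ count-remove (0 <?_) (s≤s k≤r) 1≤k ⟨
  count (0 <?_) (suc r)            ≡⟨ count-above 0 (suc r) ⟩
  r                                ∎) (<-irrefl refl)
  where
  open ≤-Reasoning
  positive≢k? = (0 <?_) ∩? ∁? (_≟ k)
  maps : ∀ {j} → j < r → j < r → f j < suc r × 0 < f j × f j ≢ k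
  maps j<r _ = s≤s (proj₂ (range j<r)) , proj₁ (range j<r) , λ fj≡k → miss (_ , j<r , fj≡k)

<-suc-elim : ∀ {C : ℕ → Set r} {n} → (∀ {k} → k < n → C k) → C n → ∀ {k} → k < suc n → C k
<-suc-elim below top k<1+n with m<1+n⇒m<n∨m≡n k<1+n
... | inj₁ k<n  = below k<n
... | inj₂ refl = top

module _ {_≼_ : Rel ℕ r} (≼-trans : Transitive _≼_) (≼-total : Total _≼_)
         {P : Pred ℕ p} (P? : Decidable P) (w : ℕ → ℕ) where

  private
    ≼-refl : ∀ {v} → v ≼ v
    ≼-refl {v} = [ id , id ]′ (≼-total v v)

    Extremal : ℕ → ℕ → Set _
    Extremal n m = m < n × P m × (∀ {k} → k < n → P k → w k ≼ w m)

    extremal? : ∀ n → (∀ {k} → k < n → ¬ P k) ⊎ ∃ (Extremal n)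
    extremal? zero = inj₁ λ ()
    extremal? (suc n) with P? n | extremal? n
    ... | no ¬Pn | inj₁ none = inj₁ (<-suc-elim none ¬Pn)
    ... | no ¬Pn | inj₂ (m , m<n , Pm , ext) =
      inj₂ (m , m<n⇒m<1+n m<n , Pm , <-suc-elim ext (λ Pn → contradiction Pn ¬Pn))
    ... | yes Pn | inj₁ none =
      inj₂ (n , ≤-refl , Pn , <-suc-elim (λ k<n Pk → contradiction Pk (none k<n)) (λ _ → ≼-refl {w n}))
    ... | yes Pn | inj₂ (m , m<n , Pm , ext) with ≼-total (w n) (w m)
    ...   | inj₁ n≼m = inj₂ (m , m<n⇒m<1+n m<n , Pm , <-suc-elim ext (λ _ → n≼m))
    ...   | inj₂ m≼n =
      inj₂ (n , ≤-refl , Pn , <-suc-elim (λ k<n Pk → ≼-trans (ext k<n Pk) m≼n) (λ _ → ≼-refl {w n}))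

  extremal : ∀ {n k} → k < n → P k → ∃ λ m → m < n × P m × (∀ {k′} → k′ < n → P k′ → w k′ ≼ w m)
  extremal {n} k<n Pk with extremal? n
  ... | inj₁ none = contradiction Pk (none k<n)
  ... | inj₂ ext  = ext

argmax : {P : Pred ℕ p} (P? : Decidable P) (w : ℕ → ℕ) → ∀ {n k} → k < n → P k →
         ∃ λ m → m < n × P m × (∀ {k′} → k′ < n → P k′ → w k′ ≤ w m)
argmax = extremal ≤-trans ≤-total

argmin : {P : Pred ℕ p} (P? : Decidable P) (w : ℕ → ℕ) → ∀ {n k} → k < n → P k →
         ∃ λ m → m < n × P m × (∀ {k′} → k′ < n → P k′ → w m ≤ w k′)
argmin = extremal (flip ≤-trans) (flip ≤-total)

m∸n+[n∸1]<m : ∀ {m n} → 1 ≤ n → n ≤ m → (m ∸ n) + (n ∸ 1) < m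
m∸n+[n∸1]<m {suc m} {suc n} _ (s≤s n≤m) = s≤s (≤-reflexive (m∸n+n≡m n≤m))

module ListRemoval {a} {A : Set a} (_≟_ : DecidableEquality A) where

  remove : A → List A → List A
  remove x = filter (λ y → ¬? (x ≟ y))

  ∈-remove⁺ : ∀ {x y xs} → y ∈ xs → x ≢ y → y ∈ remove x xs
  ∈-remove⁺ = ∈-filter⁺ _

  ∈-remove⁻ : ∀ {x y} xs → y ∈ remove x xs → y ∈ xs × x ≢ y
  ∈-remove⁻ xs = ∈-filter⁻ _ {xs = xs}

  length-remove-∉ : ∀ {x xs} → x ∉ xs → length (remove x xs) ≡ length xs
  length-remove-∉ x∉xs = cong length (filter-all _ (¬Any⇒All¬ _ x∉xs))

  length-remove-∈ : ∀ {x xs} → Unique xs → x ∈ xs → length xs ≡ suc (length (remove x xs))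
  length-remove-∈ {x} {_ ∷ xs} (x∉xs ∷ _) (here refl) = cong suc (sym (begin
    length (remove x (x ∷ xs))  ≡⟨ cong length (filter-reject (λ y → ¬? (x ≟ y)) (λ x≢x → x≢x refl)) ⟩
    length (remove x xs)        ≡⟨ length-remove-∉ (All¬⇒¬Any x∉xs) ⟩
    length xs                   ∎))
    where open ≡-Reasoning
  length-remove-∈ {x} {y ∷ xs} (y∉xs ∷ unique) (there x∈xs) = cong suc (begin
    length xs                   ≡⟨ length-remove-∈ unique x∈xs ⟩
    suc (length (remove x xs))  ≡⟨ cong length (filter-accept (λ y → ¬? (x ≟ y)) x≢y) ⟨
    length (remove x (y ∷ xs))  ∎)
    where
    open ≡-Reasoning
    x≢y : x ≢ y
    x≢y x≡y = All.lookup y∉xs x∈xs (sym x≡y)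

open ListRemoval ℤ._≟_

-- Kernels and list colourings of a labelled grid

Cells : Set₁
Cells = Pred (ℕ × ℕ) 0ℓ

module Grid (ℓ M : ℕ) (L : ℕ → ℕ → ℕ) (D : Cells)
            (D-bounded : ∀ {i j} → D (i , j) → i < ℓ × j < M)
            (L-row-injective : ∀ {i j j′} → D (i , j) → D (i , j′) → L i j ≡ L i j′ → j ≡ j′)
            (L-column-injective : ∀ {i i′ j} → D (i , j) → D (i′ , j) → L i j ≡ L i′ j → i ≡ i′)
            where

  -- The cells of D form a digraph in which every row points towards larger labels and every
  -- column towards smaller ones; Absorbed K i j says that (i , j) has an out-neighbour in K.
  Absorbed : Cells → ℕ → ℕ → Set
  Absorbed K i j = (∃ λ j′ → K (i , j′) × L i j < L i j′) ⊎ (∃ λ i′ → K (i′ , j) × L i′ j < L i j)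

  record Kernel (U : Cells) : Set₁ where
    field
      K             : Cells
      K?            : Decidable K
      K⊆U           : K ⊆ U
      row-unique    : ∀ {i j j′} → K (i , j) → K (i , j′) → j ≡ j′
      column-unique : ∀ {i i′ j} → K (i , j) → K (i′ , j) → i ≡ i′
      absorbing     : ∀ {i j} → U (i , j) → ¬ K (i , j) → Absorbed K i j

  RowMaximal : Cells → Cells
  RowMaximal U (i , j) = U (i , j) × (∀ {j′} → j′ < M → U (i , j′) → L i j′ ≤ L i j)

  rowMaximal? : ∀ {U : Cells} → Decidable U → Decidable (RowMaximal U)
  rowMaximal? U? (i , j) = U? (i , j) ×-dec allUpTo? (λ j′ → U? (i , j′) →-dec L i j′ ≤? L i j) M

  rowMaxima-kernel : ∀ {U : Cells} (U? : Decidable U) → U ⊆ D →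
                     (∀ {i i′ j} → RowMaximal U (i , j) → U (i′ , j) → L i′ j ≤ L i j) →
                     Kernel U
  rowMaxima-kernel {U} U? U⊆D columnMaximal = record
    { K             = RowMaximal U
    ; K?            = rowMaximal? U?
    ; K⊆U           = proj₁
    ; row-unique    = λ (Uij , maxij) (Uij′ , maxij′) →
        L-row-injective (U⊆D Uij) (U⊆D Uij′) (≤-antisym (maxij′ (column< Uij) Uij) (maxij (column< Uij′) Uij′))
    ; column-unique = λ maxij maxi′j →
        L-column-injective (U⊆D (proj₁ maxij)) (U⊆D (proj₁ maxi′j))
          (≤-antisym (columnMaximal maxi′j (proj₁ maxij)) (columnMaximal maxij (proj₁ maxi′j)))
    ; absorbing     = absorbing
    }
    where
    column< : ∀ {i j} → U (i , j) → j < M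
    column< = proj₂ ∘ D-bounded ∘ U⊆D

    absorbing : ∀ {i j} → U (i , j) → ¬ RowMaximal U (i , j) → Absorbed (RowMaximal U) i j
    absorbing {i} {j} Uij ¬maxij with argmax (λ j′ → U? (i , j′)) (L i) (column< Uij) Uij
    ... | j* , _ , maxij* = inj₁ (j* , maxij* , ≤∧≢⇒< (proj₂ maxij* (column< Uij) Uij) j≢j*)
      where
      j≢j* : L i j ≢ L i j*
      j≢j* eq = ¬maxij (subst (λ j → RowMaximal U (i , j))
                              (sym (L-row-injective (U⊆D Uij) (U⊆D (proj₁ maxij*)) eq)) maxij*)

  kernel-after-deletion : ∀ {U : Cells} {i j i′} → U ⊆ D → RowMaximal U (i , j) → U (i′ , j) → L i j < L i′ j →
                          Kernel (U ∖ ｛ i′ , j ｝) → Kernel U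
  kernel-after-deletion {U} {i} {j} {i′} U⊆D maxij Ui′j Lij<Li′j κ = record
    { K             = K
    ; K?            = K?
    ; K⊆U           = proj₁ ∘ K⊆U
    ; row-unique    = row-unique
    ; column-unique = column-unique
    ; absorbing     = absorbing′
    }
    where
    open Kernel κ

    -- (i , j) is row-maximal, so it can only be absorbed within its column, by a cell of smaller
    -- label; that cell, or (i , j) itself if it lies in K, absorbs the deleted cell (i′ , j).
    deleted-absorbed : Absorbed K i′ j
    deleted-absorbed with K? (i , j)
    ... | yes Kij = inj₂ (i , Kij , Lij<Li′j)
    ... | no ¬Kij with absorbing (proj₁ maxij , λ eq → <-irrefl (cong (uncurry L) (sym eq)) Lij<Li′j) ¬Kij
    ...   | inj₁ (j″ , Kij″ , Lij<Lij″) =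
            contradiction (proj₂ maxij (proj₂ (D-bounded (U⊆D Uij″))) Uij″) (<⇒≱ Lij<Lij″)
            where Uij″ = proj₁ (K⊆U Kij″)
    ...   | inj₂ (i″ , Ki″j , Li″j<Lij) = inj₂ (i″ , Ki″j , <-trans Li″j<Lij Lij<Li′j)

    absorbing′ : ∀ {a b} → U (a , b) → ¬ K (a , b) → Absorbed K a b
    absorbing′ {a} {b} Uab ¬Kab with ≡-dec _≟_ _≟_ (i′ , j) (a , b)
    ... | yes refl = deleted-absorbed
    ... | no  ≢ab  = absorbing (Uab , ≢ab) ¬Kab

  rowSize : ∀ {S : Cells} → Decidable S → ℕ → ℕ
  rowSize S? i = count (λ j → S? (i , j)) M

  size : ∀ {U : Cells} → Decidable U → ℕ
  size U? = sumBelow ℓ (rowSize U?)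

  size-mono-< : ∀ {U V : Cells} (U? : Decidable U) (V? : Decidable V) → V ⊆ U →
                ∀ {i j} → i < ℓ → j < M → U (i , j) → ¬ V (i , j) → size V? < size U?
  size-mono-< U? V? V⊆U i<ℓ j<M Uij ¬Vij =
    sumBelow-mono-< ℓ (λ _ → count-mono-≤ _ _ M (λ _ → V⊆U)) i<ℓ (count-mono-< _ _ M (λ _ → V⊆U) j<M ¬Vij Uij)

  Deletable : Cells → Set
  Deletable U = ∃ λ i → i < ℓ × ∃ λ j → j < M × ∃ λ i′ → i′ < ℓ ×
                RowMaximal U (i , j) × U (i′ , j) × L i j < L i′ j

  deletable? : ∀ {U : Cells} → Decidable U → Dec (Deletable U)
  deletable? U? = anyUpTo? (λ i → anyUpTo? (λ j → anyUpTo? (λ i′ →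
                    rowMaximal? U? (i , j) ×-dec U? (i′ , j) ×-dec L i j <? L i′ j) ℓ) M) ℓ

  kernel : ∀ {U : Cells} (U? : Decidable U) → U ⊆ D → Kernel U
  kernel U? U⊆D = kernel-acc U? U⊆D (<-wellFounded (size U?))
    where
    kernel-acc : ∀ {U : Cells} (U? : Decidable U) → U ⊆ D → Acc _<_ (size U?) → Kernel U
    kernel-acc {U} U? U⊆D (acc smaller) with deletable? U?
    ... | no ¬del = rowMaxima-kernel U? U⊆D columnMaximal
      where
      columnMaximal : ∀ {i i′ j} → RowMaximal U (i , j) → U (i′ , j) → L i′ j ≤ L i j
      columnMaximal maxij Ui′j = ≮⇒≥ λ Lij<Li′j →
        let i<ℓ , j<M = D-bounded (U⊆D (proj₁ maxij)) in
        ¬del (_ , i<ℓ , _ , j<M , _ , proj₁ (D-bounded (U⊆D Ui′j)) , maxij , Ui′j , Lij<Li′j)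
    ... | yes (i , _ , j , j<M , i′ , i′<ℓ , maxij , Ui′j , Lij<Li′j) =
      kernel-after-deletion U⊆D maxij Ui′j Lij<Li′j
        (kernel-acc V? (U⊆D ∘ proj₁) (smaller (size-mono-< U? V? proj₁ i′<ℓ j<M Ui′j λ (_ , ¬≡) → ¬≡ refl)))
      where
      V? = U? ∩? ∁? (≡-dec _≟_ _≟_ (i′ , j))

  above : ∀ {S : Cells} → Decidable S → ℕ → ℕ → ℕ
  above S? i j = count (λ j′ → S? (i , j′) ×-dec L i j <? L i j′) M

  below : ∀ {S : Cells} → Decidable S → ℕ → ℕ → ℕ
  below S? i j = count (λ i′ → S? (i′ , j) ×-dec L i′ j <? L i j) ℓ

  rowSize≡1+above : ∀ {S : Cells} (S? : Decidable S) → S ⊆ D → ∀ {i j} → j < M → S (i , j) →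
                    (∀ {j′} → j′ < M → S (i , j′) → L i j ≤ L i j′) → rowSize S? i ≡ suc (above S? i j)
  rowSize≡1+above {S} S? S⊆D {i} {j} j<M Sij minimal =
    trans (count-remove (λ j′ → S? (i , j′)) j<M Sij) (cong suc (count-cong _ _ M to from))
    where
    to : ∀ {j′} → j′ < M → S (i , j′) × j′ ≢ j → S (i , j′) × L i j < L i j′
    to j′<M (Sij′ , j′≢j) =
      Sij′ , ≤∧≢⇒< (minimal j′<M Sij′) (j′≢j ∘ sym ∘ L-row-injective (S⊆D Sij) (S⊆D Sij′))

    from : ∀ {j′} → j′ < M → S (i , j′) × L i j < L i j′ → S (i , j′) × j′ ≢ j
    from _ (Sij′ , Lij<Lij′) = Sij′ , λ { refl → <-irrefl refl Lij<Lij′ }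

  -- above S? i j + below S? i j is the out-degree of (i , j) within S.
  record Admissible {S : Cells} (S? : Decidable S) (J : ℕ → List ℤ) : Set where
    field
      unique  : ∀ {i} → i < ℓ → Unique (J i)
      length≡ : ∀ {i} → i < ℓ → length (J i) ≡ rowSize S? i
      slack   : ∀ {i j} → S (i , j) → above S? i j + below S? i j < length (J i)

  below-row-minimum≡0 : ∀ {S : Cells} {S? : Decidable S} {J} → S ⊆ D → Admissible S? J →
                        ∀ {i j} → j < M → S (i , j) → (∀ {j′} → j′ < M → S (i , j′) → L i j ≤ L i j′) →
                        below S? i j ≡ 0
  below-row-minimum≡0 {S? = S?} {J} S⊆D adm {i} {j} j<M Sij minimal =
    n≤0⇒n≡0 (+-cancelˡ-≤ (above S? i j) _ 0 (≤-pred (begin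
      suc (above S? i j + below S? i j)  ≤⟨ slack Sij ⟩
      length (J i)                       ≡⟨ length≡ (proj₁ (D-bounded (S⊆D Sij))) ⟩
      rowSize S? i                       ≡⟨ rowSize≡1+above S? S⊆D j<M Sij minimal ⟩
      suc (above S? i j)                 ≡⟨ cong suc (+-identityʳ _) ⟨
      suc (above S? i j + 0)             ∎)))
    where
    open Admissible adm
    open ≤-Reasoning

  record Colouring (S : Cells) (J : ℕ → List ℤ) : Set where
    field
      colour          : ℕ → ℕ → ℤ
      row-colours     : ∀ i → i < ℓ → ∀ y → (y ∈ J i) ⇔ (∃ λ j → S (i , j) × colour i j ≡ y)
      column-distinct : ∀ i i′ j → S (i , j) → S (i′ , j) → i ≢ i′ → colour i j ≢ colour i′ j

  -- The colour class of x is a kernel K of the cells whose list contains x. It meets each of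
  -- their rows once, and every other such cell loses an out-neighbour when K is deleted.
  module ColourClass {S : Cells} (S? : Decidable S) (S⊆D : S ⊆ D) {J : ℕ → List ℤ}
                     (adm : Admissible S? J) (x : ℤ) where
    open Admissible adm

    Candidate : Cells
    Candidate (i , j) = S (i , j) × x ∈ J i

    candidate? : Decidable Candidate
    candidate? (i , j) = S? (i , j) ×-dec x ∈? J i

    open Kernel (kernel candidate? (S⊆D ∘ proj₁))

    S′ : Cells
    S′ = S ∖ K

    S′? : Decidable S′
    S′? = S? ∩? ∁? K?

    J′ : ℕ → List ℤ
    J′ i = remove x (J i)

    row< : ∀ {i j} → S (i , j) → i < ℓ
    row< = proj₁ ∘ D-bounded ∘ S⊆D

    column< : ∀ {i j} → S (i , j) → j < M
    column< = proj₂ ∘ D-bounded ∘ S⊆D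

    row-minimum : ∀ {i} → i < ℓ → x ∈ J i → ∃ λ j → S (i , j) × below S? i j ≡ 0
    row-minimum {i} i<ℓ x∈Ji =
      let j₀ , j₀<M , Sij₀        = 0<count⇒∃ _ M (subst (0 <_) (length≡ i<ℓ) (∈-length x∈Ji))
          j , j<M , Sij , minimal = argmin (λ j → S? (i , j)) (L i) j₀<M Sij₀
      in j , Sij , below-row-minimum≡0 S⊆D adm j<M Sij minimal

    kernel-meets-row : ∀ {i} → i < ℓ → x ∈ J i → ∃ λ j → K (i , j)
    kernel-meets-row {i} i<ℓ x∈Ji with row-minimum i<ℓ x∈Ji
    ... | j , Sij , below≡0 with K? (i , j)
    ...   | yes Kij = j , Kij
    ...   | no ¬Kij with absorbing (Sij , x∈Ji) ¬Kij
    ...     | inj₁ (j′ , Kij′ , _)       = j′ , Kij′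
    ...     | inj₂ (i′ , Ki′j , Li′j<Lij) =
              contradiction (Si′j , Li′j<Lij) (count≡0⇒¬ _ below≡0 (row< Si′j))
              where Si′j = proj₁ (K⊆U Ki′j)

    length≡′ : ∀ {i} → i < ℓ → length (J′ i) ≡ rowSize S′? i
    length≡′ {i} i<ℓ with x ∈? J i
    ... | no x∉Ji = begin
      length (J′ i)  ≡⟨ length-remove-∉ x∉Ji ⟩
      length (J i)   ≡⟨ length≡ i<ℓ ⟩
      rowSize S? i   ≡⟨ count-cong _ _ M (λ _ Sij → Sij , λ Kij → x∉Ji (proj₂ (K⊆U Kij))) (λ _ → proj₁) ⟩
      rowSize S′? i  ∎
      where open ≡-Reasoning
    ... | yes x∈Ji with kernel-meets-row i<ℓ x∈Ji
    ...   | j₀ , Kij₀ = suc-injective (begin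
      suc (length (J′ i))                                  ≡⟨ length-remove-∈ (unique i<ℓ) x∈Ji ⟨
      length (J i)                                         ≡⟨ length≡ i<ℓ ⟩
      rowSize S? i                                         ≡⟨ count-remove _ (column< Sij₀) Sij₀ ⟩
      suc (count (λ j → S? (i , j) ×-dec ¬? (j ≟ j₀)) M)  ≡⟨ cong suc (count-cong _ _ M to from) ⟩
      suc (rowSize S′? i)                                  ∎)
      where
      open ≡-Reasoning
      Sij₀ = proj₁ (K⊆U Kij₀)

      to : ∀ {j} → j < M → S (i , j) × j ≢ j₀ → S′ (i , j)
      to _ (Sij , j≢j₀) = Sij , λ Kij → j≢j₀ (row-unique Kij Kij₀)

      from : ∀ {j} → j < M → S′ (i , j) → S (i , j) × j ≢ j₀
      from _ (Sij , ¬Kij) = Sij , λ { refl → ¬Kij Kij₀ }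

    above-mono-≤ : ∀ i j → above S′? i j ≤ above S? i j
    above-mono-≤ i j = count-mono-≤ _ _ M λ _ ((Sij′ , _) , lt) → Sij′ , lt

    below-mono-≤ : ∀ i j → below S′? i j ≤ below S? i j
    below-mono-≤ i j = count-mono-≤ _ _ ℓ λ _ ((Si′j , _) , lt) → Si′j , lt

    above-mono-< : ∀ {i j j′} → K (i , j′) → L i j < L i j′ → above S′? i j < above S? i j
    above-mono-< Kij′ lt = count-mono-< _ _ M (λ _ ((Sij″ , _) , lt′) → Sij″ , lt′)
                             (column< Sij′) (λ ((_ , ¬Kij′) , _) → ¬Kij′ Kij′) (Sij′ , lt)
      where Sij′ = proj₁ (K⊆U Kij′)

    below-mono-< : ∀ {i i′ j} → K (i′ , j) → L i′ j < L i j → below S′? i j < below S? i j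
    below-mono-< Ki′j lt = count-mono-< _ _ ℓ (λ _ ((Si″j , _) , lt′) → Si″j , lt′)
                             (row< Si′j) (λ ((_ , ¬Ki′j) , _) → ¬Ki′j Ki′j) (Si′j , lt)
      where Si′j = proj₁ (K⊆U Ki′j)

    slack′ : ∀ {i j} → S′ (i , j) → above S′? i j + below S′? i j < length (J′ i)
    slack′ {i} {j} (Sij , ¬Kij) with x ∈? J i
    ... | no x∉Ji = begin-strict
      above S′? i j + below S′? i j  ≤⟨ +-mono-≤ (above-mono-≤ i j) (below-mono-≤ i j) ⟩
      above S? i j + below S? i j    <⟨ slack Sij ⟩
      length (J i)                   ≡⟨ length-remove-∉ x∉Ji ⟨
      length (J′ i)                  ∎
      where open ≤-Reasoning
    ... | yes x∈Ji = ≤-pred (begin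
      suc (suc (above S′? i j + below S′? i j))  ≤⟨ s≤s absorption-decreases ⟩
      suc (above S? i j + below S? i j)          ≤⟨ slack Sij ⟩
      length (J i)                               ≡⟨ length-remove-∈ (unique (row< Sij)) x∈Ji ⟩
      suc (length (J′ i))                        ∎)
      where
      open ≤-Reasoning
      absorption-decreases : above S′? i j + below S′? i j < above S? i j + below S? i j
      absorption-decreases with absorbing (Sij , x∈Ji) ¬Kij
      ... | inj₁ (_ , Kij′ , lt) = +-mono-<-≤ (above-mono-< Kij′ lt) (below-mono-≤ i j)
      ... | inj₂ (_ , Ki′j , lt) = +-mono-≤-< (above-mono-≤ i j) (below-mono-< Ki′j lt)

    admissible′ : Admissible S′? J′
    admissible′ = record
      { unique  = Unique.filter⁺ _ ∘ unique
      ; length≡ = length≡′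
      ; slack   = slack′
      }

    extend : Colouring S′ J′ → Colouring S J
    extend c = record
      { colour          = colour
      ; row-colours     = row-colours
      ; column-distinct = column-distinct
      }
      where
      open Colouring c
        renaming (colour to colour′; row-colours to row-colours′; column-distinct to column-distinct′)

      colour : ℕ → ℕ → ℤ
      colour i j with K? (i , j)
      ... | yes _ = x
      ... | no  _ = colour′ i j

      colour-cases : ∀ {i j} → S (i , j) →
                     (K (i , j) × colour i j ≡ x) ⊎ (S′ (i , j) × colour i j ≡ colour′ i j)
      colour-cases {i} {j} Sij with K? (i , j)
      ... | yes Kij = inj₁ (Kij , refl)
      ... | no ¬Kij = inj₂ ((Sij , ¬Kij) , refl)

      colour-K : ∀ {i j} → K (i , j) → colour i j ≡ x
      colour-K {i} {j} Kij with K? (i , j)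
      ... | yes _   = refl
      ... | no ¬Kij = contradiction Kij ¬Kij

      colour-S′ : ∀ {i j} → ¬ K (i , j) → colour i j ≡ colour′ i j
      colour-S′ {i} {j} ¬Kij with K? (i , j)
      ... | yes Kij = contradiction Kij ¬Kij
      ... | no _    = refl

      colour′∈J∖x : ∀ {i j} → S′ (i , j) → colour′ i j ∈ J i × x ≢ colour′ i j
      colour′∈J∖x {i} {j} S′ij =
        ∈-remove⁻ (J i) (Equivalence.from (row-colours′ i (row< (proj₁ S′ij)) _) (j , S′ij , refl))

      row-colours : ∀ i → i < ℓ → ∀ y → (y ∈ J i) ⇔ (∃ λ j → S (i , j) × colour i j ≡ y)
      row-colours i i<ℓ y = mk⇔ to from
        where
        to : y ∈ J i → ∃ λ j → S (i , j) × colour i j ≡ y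
        to y∈Ji with x ℤ.≟ y
        ... | yes refl = let j , Kij = kernel-meets-row i<ℓ y∈Ji in j , proj₁ (K⊆U Kij) , colour-K Kij
        ... | no x≢y   = let j , S′ij , eq = Equivalence.to (row-colours′ i i<ℓ y) (∈-remove⁺ y∈Ji x≢y)
                         in j , proj₁ S′ij , trans (colour-S′ (proj₂ S′ij)) eq

        from : (∃ λ j → S (i , j) × colour i j ≡ y) → y ∈ J i
        from (j , Sij , eq) with colour-cases Sij
        ... | inj₁ (Kij , cx)   = subst (_∈ J i) (trans (sym cx) eq) (proj₂ (K⊆U Kij))
        ... | inj₂ (S′ij , c′)  = subst (_∈ J i) (trans (sym c′) eq) (proj₁ (colour′∈J∖x S′ij))

      column-distinct : ∀ i i′ j → S (i , j) → S (i′ , j) → i ≢ i′ → colour i j ≢ colour i′ j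
      column-distinct i i′ j Sij Si′j i≢i′ with colour-cases Sij | colour-cases Si′j
      ... | inj₁ (Kij , _) | inj₁ (Ki′j , _) = contradiction (column-unique Kij Ki′j) i≢i′
      ... | inj₁ (_ , c) | inj₂ (S′i′j , c′) = λ eq → proj₂ (colour′∈J∖x S′i′j) (trans (sym c) (trans eq c′))
      ... | inj₂ (S′ij , c′) | inj₁ (_ , c) = λ eq → proj₂ (colour′∈J∖x S′ij) (trans (sym c) (trans (sym eq) c′))
      ... | inj₂ (S′ij , c′) | inj₂ (S′i′j , c″) = λ eq →
        column-distinct′ i i′ j S′ij S′i′j i≢i′ (trans (sym c′) (trans eq c″))

  colouring : ∀ (V : List ℤ) {S : Cells} (S? : Decidable S) {J : ℕ → List ℤ} → S ⊆ D →
              (∀ {i} → i < ℓ → ∀ {y} → y ∈ J i → y ∈ V) → Admissible S? J → Colouring S J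
  colouring [] {S} S? {J} S⊆D J⊆[] adm = record
    { colour          = λ _ _ → 0ℤ
    ; row-colours     = λ i i<ℓ y → mk⇔ (λ y∈Ji → contradiction (J⊆[] i<ℓ y∈Ji) λ ())
                                        (λ (_ , Sij , _) → contradiction Sij empty)
    ; column-distinct = λ _ _ _ Sij _ _ → contradiction Sij empty
    }
    where
    open Admissible adm

    no-colours : ∀ {i} → i < ℓ → length (J i) ≡ 0
    no-colours {i} i<ℓ with J i | J⊆[] i<ℓ
    ... | []    | _   = refl
    ... | _ ∷ _ | ⊆[] = contradiction (⊆[] (here refl)) λ ()

    empty : ∀ {i j} → ¬ S (i , j)
    empty Sij = let i<ℓ , j<M = D-bounded (S⊆D Sij) in
      count≡0⇒¬ _ (trans (sym (length≡ i<ℓ)) (no-colours i<ℓ)) j<M Sij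
  colouring (x ∷ V) S? {J} S⊆D J⊆x∷V adm = extend (colouring V S′? (S⊆D ∘ proj₁) J′⊆V admissible′)
    where
    open ColourClass S? S⊆D adm x

    J′⊆V : ∀ {i} → i < ℓ → ∀ {y} → y ∈ J′ i → y ∈ V
    J′⊆V {i} i<ℓ y∈J′i with ∈-remove⁻ (J i) y∈J′i
    ... | y∈Ji , x≢y with J⊆x∷V i<ℓ y∈Ji
    ...   | here y≡x  = contradiction (sym y≡x) x≢y
    ...   | there y∈V = y∈V

-- Young diagrams and Latin tableaux

row<length : ∀ la {i j} → j < row la i → i < length la
row<length (_ ∷ _)  {zero}  _   = z<s
row<length (_ ∷ la) {suc i} j<r = s≤s (row<length la j<r)

row≤sum : ∀ la i → row la i ≤ sum la
row≤sum []       _       = z≤n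
row≤sum (x ∷ la) zero    = m≤m+n x (sum la)
row≤sum (x ∷ la) (suc i) = ≤-trans (row≤sum la i) (m≤n+m (sum la) x)

countBelow-hit : ∀ f {k n j} → j < n → f j ≡ k → 0 < countBelow f k n
countBelow-hit f {k} {suc n} j<1+n fj≡k with f n ≟ k
... | yes _ = z<s
... | no fn≢k = countBelow-hit f (≤∧≢⇒< (m<1+n⇒m≤n j<1+n) λ { refl → fn≢k fj≡k }) fj≡k

conj-∷-≤ : ∀ {x k} xs → k ≤ x → conj (x ∷ xs) k ≡ suc (conj xs k)
conj-∷-≤ {k = k} _ k≤x = cong length (filter-accept (k ≤?_) k≤x)

conj-∷-≰ : ∀ {x k} xs → ¬ k ≤ x → conj (x ∷ xs) k ≡ conj xs k
conj-∷-≰ {k = k} _ k≰x = cong length (filter-reject (k ≤?_) k≰x)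

OccursInLongRows : List ℕ → (ℕ → ℕ → ℕ) → ℕ → Set
OccursInLongRows la T k = ∀ {i} → i < length la → k ≤ row la i → ∃ λ j → j < row la i × T i j ≡ k

conj≤occurrences : ∀ la {T k} → OccursInLongRows la T k → conj la k ≤ occurrences la T k
conj≤occurrences []       _      = z≤n
conj≤occurrences (x ∷ la) {T} {k} occurs with k ≤? x
... | yes k≤x = let j , j<x , T0j≡k = occurs z<s k≤x in begin
  conj (x ∷ la) k                                          ≡⟨ conj-∷-≤ la k≤x ⟩
  suc (conj la k)                                          ≤⟨ +-mono-≤ (countBelow-hit (T 0) j<x T0j≡k)
                                                                      (conj≤occurrences la (occurs ∘ s≤s)) ⟩
  countBelow (T 0) k x + occurrences la (T ∘ suc) k        ∎
  where open ≤-Reasoning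
... | no k≰x = begin
  conj (x ∷ la) k                                          ≡⟨ conj-∷-≰ la k≰x ⟩
  conj la k                                                ≤⟨ conj≤occurrences la (occurs ∘ s≤s) ⟩
  occurrences la (T ∘ suc) k                               ≤⟨ m≤n+m _ _ ⟩
  countBelow (T 0) k x + occurrences la (T ∘ suc) k        ∎
  where open ≤-Reasoning

conj<occurrences : ∀ la {T k i j} → OccursInLongRows la T k →
                   row la i < k → j < row la i → T i j ≡ k → conj la k < occurrences la T k
conj<occurrences (x ∷ la) {T} {k} {zero} occurs x<k j<x T0j≡k = begin-strict
  conj (x ∷ la) k                                          ≡⟨ conj-∷-≰ la (<⇒≱ x<k) ⟩
  conj la k                                                <⟨ +-mono-≤ (countBelow-hit (T 0) j<x T0j≡k)
                                                                      (conj≤occurrences la (occurs ∘ s≤s)) ⟩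
  countBelow (T 0) k x + occurrences la (T ∘ suc) k        ∎
  where open ≤-Reasoning
conj<occurrences (x ∷ la) {T} {k} {suc i} occurs r<k j<r Tij≡k with k ≤? x
... | yes k≤x = let j , j<x , T0j≡k = occurs z<s k≤x in begin-strict
  conj (x ∷ la) k                                          ≡⟨ conj-∷-≤ la k≤x ⟩
  suc (conj la k)                                          <⟨ +-mono-≤-< (countBelow-hit (T 0) j<x T0j≡k) below ⟩
  countBelow (T 0) k x + occurrences la (T ∘ suc) k        ∎
  where
  open ≤-Reasoning
  below = conj<occurrences la (occurs ∘ s≤s) r<k j<r Tij≡k
... | no k≰x = begin-strict
  conj (x ∷ la) k                                          ≡⟨ conj-∷-≰ la k≰x ⟩
  conj la k                                                <⟨ conj<occurrences la (occurs ∘ s≤s) r<k j<r Tij≡k ⟩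
  occurrences la (T ∘ suc) k                               ≤⟨ m≤n+m _ _ ⟩
  countBelow (T 0) k x + occurrences la (T ∘ suc) k        ∎
  where open ≤-Reasoning

module LatinTableau (la : List ℕ) {T : ℕ → ℕ → ℕ} (latin : IsLatinTableau la (conj la) T) where

  private
    ℓ = length la
    M = sum la

    rows-distinct : RowsDistinct la T
    rows-distinct = proj₁ (proj₂ latin)

    columns-distinct : ColumnsDistinct la T
    columns-distinct = proj₁ (proj₂ (proj₂ latin))

    content : ∀ k → 1 ≤ k → occurrences la T k ≡ conj la k
    content = proj₂ (proj₂ (proj₂ latin))

  positive : ∀ {i j} → j < row la i → 1 ≤ T i j
  positive = proj₁ latin _ _

  Diagram : Cells
  Diagram (i , j) = j < row la i

  diagram? : Decidable Diagram
  diagram? (i , j) = j <? row la i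

  diagram-bounded : ∀ {i j} → Diagram (i , j) → i < ℓ × j < M
  diagram-bounded {i} j<r = row<length la j<r , <-≤-trans j<r (row≤sum la i)

  row-injective : ∀ {i j j′} → Diagram (i , j) → Diagram (i , j′) → T i j ≡ T i j′ → j ≡ j′
  row-injective {i} {j} {j′} j<r j′<r eq =
    decidable-stable (j ≟ j′) λ j≢j′ → rows-distinct i j j′ j<r j′<r j≢j′ eq

  column-injective : ∀ {i i′ j} → Diagram (i , j) → Diagram (i′ , j) → T i j ≡ T i′ j → i ≡ i′
  column-injective {i} {i′} {j} j<r j<r′ eq =
    decidable-stable (i ≟ i′) λ i≢i′ → columns-distinct i i′ j j<r j<r′ i≢i′ eq

  entry-in-short-row⇒missing : ∀ {i j} → j < row la i → row la i < T i j → ¬ OccursInLongRows la T (T i j)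
  entry-in-short-row⇒missing j<r r<Tij occurs =
    <⇒≢ (conj<occurrences la occurs r<Tij j<r refl) (sym (content _ (positive j<r)))

  entry≤sum : ∀ {i j} → j < row la i → T i j ≤ M
  entry≤sum {i} {j} j<r with T i j ≤? M
  ... | yes Tij≤M = Tij≤M
  ... | no  Tij≰M = contradiction (λ {i′} _ Tij≤r′ → contradiction (≤-trans Tij≤r′ (row≤sum la i′)) Tij≰M)
                                  (entry-in-short-row⇒missing j<r (≤-<-trans (row≤sum la i) (≰⇒> Tij≰M)))

  RowBounded : ℕ → Set
  RowBounded k = ∀ {i j} → j < row la i → T i j ≡ k → k ≤ row la i

  row-bounded-step : ∀ {k} → (∀ {k′} → k < k′ → k′ ≤ M → RowBounded k′) → RowBounded k
  row-bounded-step {k} larger-bounded {i} {j} j<r refl with T i j ≤? row la i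
  ... | yes Tij≤r = Tij≤r
  ... | no  Tij≰r = ⊥-elim (entry-in-short-row⇒missing j<r (≰⇒> Tij≰r) occurs)
    where
    occurs : OccursInLongRows la T (T i j)
    occurs {i′} _ Tij≤r′ = injection-hits-every-value (row la i′) (T i′) range
                             (row-injective {i′}) (positive j<r) Tij≤r′
      where
      range : ∀ {j′} → j′ < row la i′ → 1 ≤ T i′ j′ × T i′ j′ ≤ row la i′
      range {j′} j′<r′ with T i′ j′ ≤? T i j
      ... | yes ≤Tij = positive j′<r′ , ≤-trans ≤Tij Tij≤r′
      ... | no  ≰Tij = positive j′<r′ , larger-bounded (≰⇒> ≰Tij) (entry≤sum j′<r′) j′<r′ refl

  -- Descending induction on k, where d bounds M ∸ k and no entry exceeds M.
  row-bounded : ∀ d {k} → M ≤ d + k → RowBounded k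
  row-bounded zero    M≤k   = row-bounded-step λ k<k′ k′≤M → contradiction (≤-trans k′≤M M≤k) (<⇒≱ k<k′)
  row-bounded (suc d) {k} M≤1+d+k = row-bounded-step λ {k′} k<k′ _ →
    row-bounded d (≤-trans M≤1+d+k (≤-trans (≤-reflexive (sym (+-suc d k))) (+-monoʳ-≤ d k<k′)))

  entry≤row : ∀ {i j} → j < row la i → T i j ≤ row la i
  entry≤row j<r = row-bounded M (m≤m+n M _) j<r refl

  open Grid ℓ M T Diagram diagram-bounded row-injective column-injective

  above≤ : ∀ {i j} → j < row la i → above diagram? i j ≤ row la i ∸ T i j
  above≤ {i} {j} j<r = begin
    above diagram? i j               ≤⟨ count-injection _ (T i j <?_) (T i) M (suc (row la i))
                                          (λ _ (j′<r , Tij<Tij′) → s≤s (entry≤row j′<r) , Tij<Tij′)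
                                          (λ _ _ (j′<r , _) (j″<r , _) → row-injective j′<r j″<r) ⟩
    count (T i j <?_) (suc (row la i)) ≡⟨ count-above (T i j) (suc (row la i)) ⟩
    row la i ∸ T i j                 ∎
    where open ≤-Reasoning

  below≤ : ∀ {i j} → j < row la i → below diagram? i j ≤ T i j ∸ 1
  below≤ {i} {j} j<r = begin
    below diagram? i j               ≤⟨ count-injection _ (0 <?_) (λ i′ → T i′ j) ℓ (T i j)
                                          (λ _ (j<r′ , Ti′j<Tij) → Ti′j<Tij , positive j<r′)
                                          (λ _ _ (j<r′ , _) (j<r″ , _) → column-injective j<r′ j<r″) ⟩
    count (0 <?_) (T i j)            ≡⟨ count-above 0 (T i j) ⟩
    T i j ∸ 1                        ∎
    where open ≤-Reasoning

  slack : ∀ {i j} → j < row la i → above diagram? i j + below diagram? i j < row la i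
  slack j<r = ≤-<-trans (+-mono-≤ (above≤ j<r) (below≤ j<r)) (m∸n+[n∸1]<m (positive j<r) (entry≤row j<r))

  stronglyLatin : StronglyLatin la
  stronglyLatin I I-valid = colour , row-colours , column-distinct
    where
    rows-valid : ∀ {i} → i < ℓ → length (I i) ≡ row la i
    rows-valid i<ℓ = proj₂ (I-valid _ i<ℓ)

    admissible : Admissible diagram? I
    admissible = record
      { unique  = proj₁ ∘ I-valid _
      ; length≡ = λ {i} i<ℓ → trans (rows-valid i<ℓ) (sym (count-below M (row≤sum la i)))
      ; slack   = λ j<r → subst (_ <_) (sym (rows-valid (row<length la j<r))) (slack j<r)
      }

    open Colouring (colouring (concat (applyUpTo I ℓ)) diagram? id
                              (λ i<ℓ y∈Ii → ∈-concat⁺′ y∈Ii (∈-applyUpTo⁺ I i<ℓ)) admissible)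

-- The argument never uses that the row lengths are weakly decreasing.
theorem1 : (la : List ℕ) → IsPartition la → Latin la → StronglyLatin la
theorem1 la _ (_ , latin) = LatinTableau.stronglyLatin la latin
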